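{- Let $n\ge 27$. For each integer $a$ with $5\le a\le \lfloor (n-12)/3\rfloor$ and $n-a\equiv 0\pmod 2$, the partition $\left(\tfrac12(n-a-10),\ a+1,\ 6,\ 5,\ 3,\ 1\times\tfrac12(n-a-20)\right)$ of $n$ corresponds to the eigenvalue $\binom a2-2$ of $\mathrm{Cay}(S_n,T_n)$.
   Context: $\mathrm{Cay}(S_n,T_n)$ is the Cayley graph on the symmetric group $S_n$ generated by the set $T_n$ of all transpositions ($f\sim g$ iff $fg^{ -1}\in T_n$). For a partition $\lambda=(\lambda_1,\dots,\lambda_k)$ of $n$ (parts listed in the order written), put $\rho_\lambda=\sum_{i=1}^k \lambda_i(\lambda_i-2i+1)/2$; the eigenvalues of $\mathrm{Cay}(S_n,T_n)$ are exactly the numbers $\rho_\lambda$ as $\lambda$ ranges over partitions of $n$, and $\lambda$ is said to correspond to the eigenvalue $\rho_\lambda$. The notation $(\mu_1\times t_1,\dots,\mu_r\times t_r)$ denotes the sequence in which $\mu_i$ is repeated $t_i$ times; an entry $\mu$ without "$\times t$" is a single part, and $\mu\times 0$ contributes no parts. -}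

module Defs where

open import Data.Nat using (ℕ; zero; suc; _≥_; _>_)
open import Data.Integer using (ℤ; +_; _+_; _-_; _*_)
open import Data.Integer.DivMod using (_/_)
open import Data.List using (List; []; _∷_)
open import Data.Nat.ListAction using (sum)
open import Data.List.Relation.Unary.All using (All)
open import Data.List.Relation.Unary.Linked using (Linked)
open import Data.Product using (_×_)
open import Relation.Binary.PropositionalEquality using (_≡_)

IsPartitionOf : ℕ → List ℕ → Set
IsPartitionOf n λs = (sum λs ≡ n) × All (λ p → p > 0) λs × Linked _≥_ λs

-- ρ-term for the part λᵢ at (1-based) position i : λᵢ(λᵢ - 2i + 1)/2
-- (the numerator is always even, so the integer division is exact).
ρterm : ℕ → ℕ → ℤ
ρterm i l = ((+ l) * ((+ l) - (+ 2) * (+ i) + (+ 1))) / (+ 2)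

ρFrom : ℕ → List ℕ → ℤ
ρFrom i [] = + 0
ρFrom i (l ∷ ls) = ρterm i l + ρFrom (suc i) ls

ρ : List ℕ → ℤ
ρ λs = ρFrom 1 λs

CorrespondsTo : List ℕ → ℤ → Set
CorrespondsTo λs r = ρ λs ≡ r

{-# OPTIONS --safe #-}
module Submission where

-- Writing n = a + 20 + 2r, the partition is (r + 5, a + 1, 6, 5, 3, 1 × r), and the bound
-- a ≤ (n - 12)/3 becomes a ≤ r + 4, i.e. r + 5 ≥ a + 1. Doubling ρ clears the exact halving
-- in each term, and the doubled sum is a polynomial identity in a and r:
-- (r + 5)(r + 4) + (a + 1)(a - 2) + 6 - 10 - 18 - r(r + 9) = a(a - 1) - 4 = 2 (C(a,2) - 2);
-- the dependence on r cancels between the first part and the trailing ones.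

open import Defs
open import Data.Nat using (ℕ; _≤_; _∸_; _+_; _/_; _%_)
open import Data.Nat.Combinatorics using (_C_)
open import Data.Integer using (+_) renaming (_-_ to _-ℤ_)
open import Data.List using (_∷_; replicate)
open import Data.Product using (_×_)
open import Relation.Binary.PropositionalEquality using (_≡_)

open import Data.Nat using (zero; suc; _*_; _≥_; _>_; NonZero; s≤s; z≤n; z<s)
import Data.Nat.Properties as ℕ
open import Data.Nat.DivMod using (m*n/n≡m; m*n%n≡0; m/n*n≡m; m/n*n≤m)
open import Data.Nat.Divisibility using (m%n≡0⇒n∣m)
import Data.Nat.Tactic.RingSolver as ℕ-Solver
open import Data.Nat.Combinatorics using (nC1≡n; nCk+nC[k+1]≡[n+1]C[k+1])
open import Data.Nat.ListAction using (sum)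
open import Data.Integer using (ℤ; -[1+_])
import Data.Integer as ℤ
import Data.Integer.Properties as ℤ
import Data.Integer.Tactic.RingSolver as ℤ-Solver
open import Data.List using (List; [])
open import Data.List.Relation.Unary.All using (All; _∷_)
open import Data.List.Relation.Unary.All.Properties using (replicate⁺)
open import Data.List.Relation.Unary.Linked using (Linked; [-]; _∷_)
open import Data.Product using (_,_; ∃-syntax)
open import Relation.Binary.PropositionalEquality using (refl; sym; trans; cong; cong₂; subst; subst₂; module ≡-Reasoning)

i*n/n≡i : ∀ i n .{{_ : NonZero n}} → i ℤ.* + n ℤ./ + n ≡ i
i*n/n≡i (+ m) n rewrite sym (ℤ.pos-* m n) =
  trans (ℤ.*-identityˡ _) (cong +_ (m*n/n≡m m n))
i*n/n≡i -[1+ m ] (suc k) rewrite m*n%n≡0 (suc m) (suc k) {{_}} =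
  trans (ℤ.*-identityˡ _) (cong (λ q → ℤ.- (+ q)) (m*n/n≡m (suc m) (suc k)))

nC2*2≡n*[n-1] : ∀ n → + (n C 2) ℤ.* + 2 ≡ + n ℤ.* (+ n ℤ.- + 1)
nC2*2≡n*[n-1] zero = refl
nC2*2≡n*[n-1] (suc n) = begin
  + (suc n C 2) ℤ.* + 2                  ≡⟨ cong (λ c → + c ℤ.* + 2) (sym (nCk+nC[k+1]≡[n+1]C[k+1] n 1)) ⟩
  + (n C 1 + n C 2) ℤ.* + 2              ≡⟨ cong (λ c → + (c + n C 2) ℤ.* + 2) (nC1≡n n) ⟩
  (+ n ℤ.+ + (n C 2)) ℤ.* + 2            ≡⟨ ℤ.*-distribʳ-+ (+ 2) (+ n) (+ (n C 2)) ⟩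
  + n ℤ.* + 2 ℤ.+ + (n C 2) ℤ.* + 2      ≡⟨ cong (ℤ._+_ (+ n ℤ.* + 2)) (nC2*2≡n*[n-1] n) ⟩
  + n ℤ.* + 2 ℤ.+ + n ℤ.* (+ n ℤ.- + 1) ≡⟨ expand (+ n) ⟩
  + suc n ℤ.* (+ suc n ℤ.- + 1)          ∎
  where
  open ≡-Reasoning
  expand : ∀ m → m ℤ.* + 2 ℤ.+ m ℤ.* (m ℤ.- + 1) ≡ (+ 1 ℤ.+ m) ℤ.* ((+ 1 ℤ.+ m) ℤ.- + 1)
  expand = ℤ-Solver.solve-∀

twiceρFrom : ℕ → List ℕ → ℤ
twiceρFrom i []       = + 0
twiceρFrom i (l ∷ ls) = + l ℤ.* (+ l ℤ.- + 2 ℤ.* + i ℤ.+ + 1) ℤ.+ twiceρFrom (suc i) ls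

ρterm*2 : ∀ i l → ρterm i l ℤ.* + 2 ≡ + l ℤ.* (+ l ℤ.- + 2 ℤ.* + i ℤ.+ + 1)
ρterm*2 i l = begin
  N ℤ./ + 2 ℤ.* + 2          ≡⟨ cong (λ m → m ℤ./ + 2 ℤ.* + 2) N≡t*2 ⟩
  t ℤ.* + 2 ℤ./ + 2 ℤ.* + 2  ≡⟨ cong (ℤ._* + 2) (i*n/n≡i t 2) ⟩
  t ℤ.* + 2                  ≡⟨ N≡t*2 ⟨
  N                          ∎
  where
  open ≡-Reasoning
  N t : ℤ
  N = + l ℤ.* (+ l ℤ.- + 2 ℤ.* + i ℤ.+ + 1)
  t = + (suc l C 2) ℤ.- + i ℤ.* + l
  split : ∀ l i → l ℤ.* (l ℤ.- + 2 ℤ.* i ℤ.+ + 1)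
                  ≡ (+ 1 ℤ.+ l) ℤ.* ((+ 1 ℤ.+ l) ℤ.- + 1) ℤ.- i ℤ.* l ℤ.* + 2
  split = ℤ-Solver.solve-∀
  factor : ∀ c x → c ℤ.* + 2 ℤ.- x ℤ.* + 2 ≡ (c ℤ.- x) ℤ.* + 2
  factor = ℤ-Solver.solve-∀
  N≡t*2 : N ≡ t ℤ.* + 2
  N≡t*2 = begin
    N                                                       ≡⟨ split (+ l) (+ i) ⟩
    + suc l ℤ.* (+ suc l ℤ.- + 1) ℤ.- + i ℤ.* + l ℤ.* + 2
      ≡⟨ cong (ℤ._- + i ℤ.* + l ℤ.* + 2) (sym (nC2*2≡n*[n-1] (suc l))) ⟩
    + (suc l C 2) ℤ.* + 2 ℤ.- + i ℤ.* + l ℤ.* + 2            ≡⟨ factor (+ (suc l C 2)) (+ i ℤ.* + l) ⟩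
    t ℤ.* + 2                                               ∎

ρFrom*2≡twiceρFrom : ∀ i ls → ρFrom i ls ℤ.* + 2 ≡ twiceρFrom i ls
ρFrom*2≡twiceρFrom i []       = refl
ρFrom*2≡twiceρFrom i (l ∷ ls) = begin
  (ρterm i l ℤ.+ ρFrom (suc i) ls) ℤ.* + 2              ≡⟨ ℤ.*-distribʳ-+ (+ 2) (ρterm i l) _ ⟩
  ρterm i l ℤ.* + 2 ℤ.+ ρFrom (suc i) ls ℤ.* + 2         ≡⟨ cong₂ ℤ._+_ (ρterm*2 i l) (ρFrom*2≡twiceρFrom (suc i) ls) ⟩
  twiceρFrom i (l ∷ ls)                                  ∎
  where open ≡-Reasoning

twiceρFrom-ones : ∀ i r → twiceρFrom i (replicate r 1) ≡ + r ℤ.* (+ 3 ℤ.- + 2 ℤ.* + i ℤ.- + r)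
twiceρFrom-ones i zero    = sym (ℤ.*-zeroˡ (+ 3 ℤ.- + 2 ℤ.* + i ℤ.- + 0))
twiceρFrom-ones i (suc r) = begin
  + 1 ℤ.* (+ 1 ℤ.- + 2 ℤ.* + i ℤ.+ + 1) ℤ.+ twiceρFrom (suc i) (replicate r 1)
    ≡⟨ cong (ℤ._+_ (+ 1 ℤ.* (+ 1 ℤ.- + 2 ℤ.* + i ℤ.+ + 1))) (twiceρFrom-ones (suc i) r) ⟩
  + 1 ℤ.* (+ 1 ℤ.- + 2 ℤ.* + i ℤ.+ + 1) ℤ.+ + r ℤ.* (+ 3 ℤ.- + 2 ℤ.* + suc i ℤ.- + r)
    ≡⟨ step (+ i) (+ r) ⟩
  + suc r ℤ.* (+ 3 ℤ.- + 2 ℤ.* + i ℤ.- + suc r) ∎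
  where
  open ≡-Reasoning
  step : ∀ i r → + 1 ℤ.* (+ 1 ℤ.- + 2 ℤ.* i ℤ.+ + 1) ℤ.+ r ℤ.* (+ 3 ℤ.- + 2 ℤ.* (+ 1 ℤ.+ i) ℤ.- r)
                 ≡ (+ 1 ℤ.+ r) ℤ.* (+ 3 ℤ.- + 2 ℤ.* i ℤ.- (+ 1 ℤ.+ r))
  step = ℤ-Solver.solve-∀

shape : ℕ → ℕ → List ℕ
shape a r = (5 + r) ∷ (a + 1) ∷ 6 ∷ 5 ∷ 3 ∷ replicate r 1

twiceρ-shape : ∀ a r → twiceρFrom 1 (shape a r) ≡ + a ℤ.* (+ a ℤ.- + 1) ℤ.- + 4
twiceρ-shape a r rewrite twiceρFrom-ones 6 r = collect (+ a) (+ r)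
  where
  collect : ∀ a r →
    (+ 5 ℤ.+ r) ℤ.* ((+ 5 ℤ.+ r) ℤ.- + 2 ℤ.* + 1 ℤ.+ + 1) ℤ.+
    ((a ℤ.+ + 1) ℤ.* ((a ℤ.+ + 1) ℤ.- + 2 ℤ.* + 2 ℤ.+ + 1) ℤ.+
    (+ 6 ℤ.* (+ 6 ℤ.- + 2 ℤ.* + 3 ℤ.+ + 1) ℤ.+
    (+ 5 ℤ.* (+ 5 ℤ.- + 2 ℤ.* + 4 ℤ.+ + 1) ℤ.+
    (+ 3 ℤ.* (+ 3 ℤ.- + 2 ℤ.* + 5 ℤ.+ + 1) ℤ.+
    r ℤ.* (+ 3 ℤ.- + 2 ℤ.* + 6 ℤ.- r)))))
    ≡ a ℤ.* (a ℤ.- + 1) ℤ.- + 4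
  collect = ℤ-Solver.solve-∀

ρ-shape : ∀ a r → ρ (shape a r) ≡ + (a C 2) ℤ.- + 2
ρ-shape a r = ℤ.*-cancelʳ-≡ _ _ (+ 2) (begin
  ρ (shape a r) ℤ.* + 2                       ≡⟨ ρFrom*2≡twiceρFrom 1 (shape a r) ⟩
  twiceρFrom 1 (shape a r)                    ≡⟨ twiceρ-shape a r ⟩
  + a ℤ.* (+ a ℤ.- + 1) ℤ.- + 4               ≡⟨ cong (ℤ._- + 4) (sym (nC2*2≡n*[n-1] a)) ⟩
  + (a C 2) ℤ.* + 2 ℤ.- + 4                   ≡⟨ factor (+ (a C 2)) ⟩
  (+ (a C 2) ℤ.- + 2) ℤ.* + 2                 ∎)
  where
  open ≡-Reasoning
  factor : ∀ c → c ℤ.* + 2 ℤ.- + 4 ≡ (c ℤ.- + 2) ℤ.* + 2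
  factor = ℤ-Solver.solve-∀

sum-replicate : ∀ n x → sum (replicate n x) ≡ n * x
sum-replicate zero    x = refl
sum-replicate (suc n) x = cong (_+_ x) (sum-replicate n x)

linked-∷-replicate : ∀ {A : Set} {R : A → A → Set} {x y : A} →
                     R y x → R x x → ∀ n → Linked R (y ∷ replicate n x)
linked-∷-replicate Ryx Rxx zero    = [-]
linked-∷-replicate Ryx Rxx (suc n) = Ryx ∷ linked-∷-replicate Rxx Rxx n

shape-isPartition : ∀ {a r} → 5 ≤ a → a ≤ 4 + r → IsPartitionOf (a + (20 + r * 2)) (shape a r)
shape-isPartition {a} {r} 5≤a a≤4+r = sum≡ , positive , nonincreasing
  where
  a+1≡1+a : a + 1 ≡ suc a
  a+1≡1+a = ℕ.+-comm a 1
  sum≡ : sum (shape a r) ≡ a + (20 + r * 2)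
  sum≡ rewrite sum-replicate r 1 = total a r
    where
    total : ∀ a r → 5 + r + (a + 1 + (6 + (5 + (3 + r * 1)))) ≡ a + (20 + r * 2)
    total = ℕ-Solver.solve-∀
  positive : All (_> 0) (shape a r)
  positive = z<s ∷ subst (_> 0) (sym a+1≡1+a) z<s ∷ z<s ∷ z<s ∷ z<s ∷ replicate⁺ r z<s
  nonincreasing : Linked _≥_ (shape a r)
  nonincreasing = subst (_≤ 5 + r) (sym a+1≡1+a) (s≤s a≤4+r)
                ∷ subst (6 ≤_) (sym a+1≡1+a) (s≤s 5≤a)
                ∷ ℕ.n≤1+n 5
                ∷ ℕ.m≤n+m 3 2
                ∷ linked-∷-replicate (s≤s z≤n) ℕ.≤-refl r

parametrise : ∀ {n a} → 27 ≤ n → 5 ≤ a → a ≤ (n ∸ 12) / 3 → (n ∸ a) % 2 ≡ 0 →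
              ∃[ r ] (n ≡ a + (20 + r * 2) × a ≤ 4 + r)
parametrise {n} {a} 27≤n 5≤a a≤[n-12]/3 n-a-even = r , n≡ , a≤4+r
  where
  open ℕ.≤-Reasoning
  k r : ℕ
  k = (n ∸ a) / 2
  r = k ∸ 10
  a*3+12≤n : a * 3 + 12 ≤ n
  a*3+12≤n = begin
    a * 3 + 12  ≤⟨ ℕ.+-monoˡ-≤ 12 (ℕ.≤-trans (ℕ.*-monoˡ-≤ 3 a≤[n-12]/3) (m/n*n≤m (n ∸ 12) 3)) ⟩
    n ∸ 12 + 12 ≡⟨ ℕ.m∸n+n≡m (ℕ.≤-trans (ℕ.m≤m+n 12 15) 27≤n) ⟩
    n           ∎
  k*2≡n∸a : k * 2 ≡ n ∸ a
  k*2≡n∸a = m/n*n≡m (m%n≡0⇒n∣m (n ∸ a) 2 n-a-even)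
  a+6≤k : a + 6 ≤ k
  a+6≤k = ℕ.*-cancelʳ-≤ (a + 6) k 2 (begin
    (a + 6) * 2            ≡⟨ ℕ.m+n∸m≡n a _ ⟨
    a + (a + 6) * 2 ∸ a    ≡⟨ cong (_∸ a) (regroup a) ⟩
    a * 3 + 12 ∸ a         ≤⟨ ℕ.∸-monoˡ-≤ a a*3+12≤n ⟩
    n ∸ a                  ≡⟨ k*2≡n∸a ⟨
    k * 2                  ∎)
    where
    regroup : ∀ a → a + (a + 6) * 2 ≡ a * 3 + 12
    regroup = ℕ-Solver.solve-∀
  k≡10+r : k ≡ 10 + r
  k≡10+r = sym (ℕ.m+[n∸m]≡n (ℕ.≤-trans (ℕ.+-monoˡ-≤ 6 (ℕ.≤-trans (ℕ.n≤1+n 4) 5≤a)) a+6≤k))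
  a≤4+r : a ≤ 4 + r
  a≤4+r = ℕ.+-cancelʳ-≤ 6 a (4 + r) (begin
    a + 6      ≤⟨ a+6≤k ⟩
    k          ≡⟨ k≡10+r ⟩
    10 + r     ≡⟨ ℕ.+-comm 6 (4 + r) ⟩
    4 + r + 6  ∎)
  n≡ : n ≡ a + (20 + r * 2)
  n≡ = begin-equality
    n              ≡⟨ ℕ.m+[n∸m]≡n (ℕ.≤-trans (ℕ.m≤m*n a 3) (ℕ.≤-trans (ℕ.m≤m+n (a * 3) 12) a*3+12≤n)) ⟨
    a + (n ∸ a)    ≡⟨ cong (_+_ a) k*2≡n∸a ⟨
    a + k * 2      ≡⟨ cong (λ m → a + m * 2) k≡10+r ⟩
    a + (20 + r * 2) ∎

partitionFor : ℕ → ℕ → List ℕ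
partitionFor n a = ((n ∸ a ∸ 10) / 2) ∷ (a + 1) ∷ 6 ∷ 5 ∷ 3 ∷ replicate ((n ∸ a ∸ 20) / 2) 1

partitionFor≡shape : ∀ a r → partitionFor (a + (20 + r * 2)) a ≡ shape a r
partitionFor≡shape a r rewrite ℕ.m+n∸m≡n a (20 + r * 2) =
  cong₂ (λ p q → p ∷ (a + 1) ∷ 6 ∷ 5 ∷ 3 ∷ replicate q 1) (m*n/n≡m (5 + r) 2) (m*n/n≡m r 2)

lemma3p8 : ∀ (n a : ℕ) → 27 ≤ n → 5 ≤ a → a ≤ (n ∸ 12) / 3 → (n ∸ a) % 2 ≡ 0 →
    IsPartitionOf n (((n ∸ a ∸ 10) / 2) ∷ (a + 1) ∷ 6 ∷ 5 ∷ 3 ∷ replicate ((n ∸ a ∸ 20) / 2) 1)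
    × CorrespondsTo (((n ∸ a ∸ 10) / 2) ∷ (a + 1) ∷ 6 ∷ 5 ∷ 3 ∷ replicate ((n ∸ a ∸ 20) / 2) 1)
        ((+ (a C 2)) -ℤ (+ 2))
lemma3p8 n a 27≤n 5≤a a≤[n-12]/3 n-a-even =
  let r , n≡ , a≤4+r = parametrise 27≤n 5≤a a≤[n-12]/3 n-a-even
      shape≡ = trans (sym (partitionFor≡shape a r)) (cong (λ m → partitionFor m a) (sym n≡))
  in subst₂ (λ m λs → IsPartitionOf m λs × CorrespondsTo λs (+ (a C 2) -ℤ + 2)) (sym n≡) shape≡
            (shape-isPartition 5≤a a≤4+r , ρ-shape a r)
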